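{- Let $A$, $B$, $m$, $n$ be positive integers such that $m$ and $n$ are coprime, and let $S = \{am+bn : a\in\{0,\ldots,A\},\ b\in\{0,\ldots,B\}\}$. If $A \ge n$ and $B \ge m$, then $|S| \le Am + Bn + 1 - (m-1)(n-1)$. -}

module Defs where

open import Data.Nat using (ℕ; _+_; _*_)
open import Data.Nat.Properties using (_≟_)
open import Data.List using (List; upTo; concatMap; map; deduplicate; length)

sumsList : (A B m n : ℕ) → List ℕ
sumsList A B m n =
  concatMap (λ a → map (λ b → a * m + b * n) (upTo (B + 1))) (upTo (A + 1))

cardS : (A B m n : ℕ) → ℕ
cardS A B m n = length (deduplicate _≟_ (sumsList A B m n))

-- Put T = Am + Bn. As m and n are coprime, a number has at most one representation am + bn
-- with 0 ≤ a < n. Hence for each of the (m − 1)(n − 1) interior points z = am + bn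
-- (0 < a < n, 0 < b < m) the number mn − z (if z < mn) or T + mn − z (otherwise) lies in
-- [0, T] but not in S. These gaps are pairwise distinct: within a kind because z determines
-- (a, b), across kinds because a collision would put an interior point above T. So S and the
-- gaps are disjoint sets of distinct numbers in [0, T], and the bound is pigeonhole.
module Submission where

open import Data.Empty using (⊥; ⊥-elim)
open import Data.Fin using (Fin; toℕ)
open import Data.Fin.Properties using (toℕ<n; toℕ-injective)
open import Data.List using (List; []; _∷_; length; filter; map; _++_; upTo; allFin; cartesianProductWith; deduplicate)
open import Data.List.Membership.Propositional using (_∈_; find)
open import Data.List.Membership.Propositional.Properties using (∈-map⁻; ∈-concatMap⁻; ∈-deduplicate⁻; ∈-upTo⁻; ∈-cartesianProductWith⁻)
open import Data.List.Properties using (length-++; length-map; length-tabulate; filter-accept; filter-reject; filter-all)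
open import Data.List.Relation.Unary.All as All using (All; _∷_)
open import Data.List.Relation.Unary.All.Properties using (all-filter; ++⁺)
open import Data.List.Relation.Unary.Unique.Propositional using (Unique; _∷_)
import Data.List.Relation.Unary.Unique.Propositional.Properties as Unique
open import Data.Nat
open import Data.Nat.Coprimality using (Coprime; coprime-divisor) renaming (sym to coprime-sym)
open import Data.Nat.Divisibility using (_∣_; divides; ∣m+n∣m⇒∣n; n∣m*n; >⇒∤)
open import Data.Nat.Properties
open import Data.List.Relation.Unary.Unique.DecPropositional.Properties _≟_ using (deduplicate-!)
open import Algebra.Properties.CommutativeSemigroup +-commutativeSemigroup using (x∙yz≈y∙xz)
open import Data.Nat.Tactic.RingSolver using (solve-∀)
open import Data.Product using (_×_; _,_; proj₁; proj₂)
open import Data.Sum using (inj₁; inj₂)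
open import Function using (_∘_)
open import Relation.Binary.PropositionalEquality
open import Relation.Nullary using (yes; no; ¬_; contradiction)

open import Defs

private variable
  a a' b b' c d e v z z' : ℕ

m<n+1⇒m≤n : ∀ {m n} → m < n + 1 → m ≤ n
m<n+1⇒m≤n {m} {n} = ≤-pred ∘ subst (m <_) (+-comm n 1)

m≤n⇒m<n+1 : ∀ {m n} → m ≤ n → m < n + 1
m≤n⇒m<n+1 {m} {n} = subst (m <_) (+-comm 1 n) ∘ s≤s

suc-toℕ<n : ∀ {k} .{{_ : NonZero k}} (i : Fin (pred k)) → suc (toℕ i) < k
suc-toℕ<n i = m≤pred[n]⇒suc[m]≤n (toℕ<n i)

length≤1+length-filter : ∀ N {xs} → Unique xs → All (_< suc N) xs →
                         length xs ≤ suc (length (filter (_<? N) xs))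
length≤1+length-filter N {[]} _ _ = z≤n
length≤1+length-filter N {x ∷ xs} (x∉xs ∷ !xs) (x≤N ∷ xs≤N) with x <? N
... | yes x<N rewrite filter-accept (_<? N) {xs = xs} x<N =
  s≤s (length≤1+length-filter N !xs xs≤N)
... | no x≮N rewrite filter-reject (_<? N) {xs = xs} x≮N =
  s≤s (≤-reflexive (cong length (sym (filter-all (_<? N) xs<N))))
  where
  x≡N : x ≡ N
  x≡N = ≤-antisym (≤-pred x≤N) (≮⇒≥ x≮N)
  xs<N : All (_< N) xs
  xs<N = All.zipWith (λ (x≢y , y≤N) → ≤∧≢⇒< (≤-pred y≤N) (λ y≡N → x≢y (trans x≡N (sym y≡N))))
                     (x∉xs , xs≤N)

unique-length≤bound : ∀ N {xs} → Unique xs → All (_< N) xs → length xs ≤ N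
unique-length≤bound zero    {[]}    _ _        = z≤n
unique-length≤bound zero    {_ ∷ _} _ (() ∷ _)
unique-length≤bound (suc N) {xs}    !xs xs<1+N = begin
  length xs                          ≤⟨ length≤1+length-filter N !xs xs<1+N ⟩
  suc (length (filter (_<? N) xs))   ≤⟨ s≤s (unique-length≤bound N (Unique.filter⁺ (_<? N) !xs) (all-filter (_<? N) xs)) ⟩
  suc N                              ∎
  where open ≤-Reasoning

length-cartesianProductWith : ∀ {A B C : Set} (f : A → B → C) xs ys →
                              length (cartesianProductWith f xs ys) ≡ length xs * length ys
length-cartesianProductWith f []       ys = refl
length-cartesianProductWith f (x ∷ xs) ys = begin
  length (map (f x) ys ++ cartesianProductWith f xs ys)            ≡⟨ length-++ (map (f x) ys) ⟩
  length (map (f x) ys) + length (cartesianProductWith f xs ys)    ≡⟨ cong₂ _+_ (length-map (f x) ys) (length-cartesianProductWith f xs ys) ⟩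
  length ys + length xs * length ys                                ∎
  where open ≡-Reasoning

module _ {m n : ℕ} .{{_ : NonZero n}} (m⊥n : Coprime m n) where

  shift<n⇒≡0 : a + e < n → a * m + b * n ≡ (a + e) * m + b' * n → e ≡ 0
  shift<n⇒≡0 {e = zero} _ _ = refl
  shift<n⇒≡0 {a} {e@(suc _)} {b} {b'} a+e<n eq =
    contradiction n∣e (>⇒∤ (≤-<-trans (m≤n+m e a) a+e<n))
    where
    b*n≡ : b * n ≡ b' * n + e * m
    b*n≡ = +-cancelˡ-≡ (a * m) _ _ (begin
      a * m + b * n              ≡⟨ eq ⟩
      (a + e) * m + b' * n       ≡⟨ regroup a e m (b' * n) ⟩
      a * m + (b' * n + e * m)   ∎)
      where
      open ≡-Reasoning
      regroup : ∀ a e m x → (a + e) * m + x ≡ a * m + (x + e * m)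
      regroup = solve-∀
    n∣e : n ∣ e
    n∣e = coprime-divisor (coprime-sym m⊥n)
            (subst (n ∣_) (*-comm e m) (∣m+n∣m⇒∣n (divides b (sym b*n≡)) (n∣m*n b')))

  combination-injectiveˡ : a ≤ a' → a' < n → a * m + b * n ≡ a' * m + b' * n → a ≡ a'
  combination-injectiveˡ {a} {b = b} {b'} a≤a' a'<n eq with e , refl ← m≤n⇒∃[o]m+o≡n a≤a' =
    sym (trans (cong (a +_) (shift<n⇒≡0 {a} {e} {b} {b'} a'<n eq)) (+-identityʳ a))

  combination-injective : a < n → a' < n → a * m + b * n ≡ a' * m + b' * n → a ≡ a' × b ≡ b'
  combination-injective {a} {a'} {b} {b'} a<n a'<n eq =
    a≡a' , *-cancelʳ-≡ b b' n (+-cancelˡ-≡ (a * m) _ _ (trans eq (cong (λ x → x * m + b' * n) (sym a≡a'))))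
    where
    a≡a' : a ≡ a'
    a≡a' with ≤-total a a'
    ... | inj₁ a≤a' = combination-injectiveˡ {b = b} {b'} a≤a' a'<n eq
    ... | inj₂ a'≤a = sym (combination-injectiveˡ {b = b'} {b} a'≤a a<n (sym eq))

  positive-combination≢m*n : 0 < c → 0 < d → c * m + d * n ≢ m * n
  positive-combination≢m*n {c} {d} 0<c 0<d eq with c <? n
  ... | yes c<n = <⇒≢ 0<c (sym (proj₁ (combination-injective {b = d} {b' = m} c<n (>-nonZero⁻¹ n) eq)))
  ... | no c≮n  = >⇒≢ m*n<c*m+d*n eq
    where
    m*n<c*m+d*n : m * n < c * m + d * n
    m*n<c*m+d*n = begin-strict
      m * n          ≡⟨ *-comm m n ⟩
      n * m          ≤⟨ *-monoˡ-≤ m (≮⇒≥ c≮n) ⟩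
      c * m          <⟨ m<m+n (c * m) (*-monoˡ-< n 0<d) ⟩
      c * m + d * n  ∎
      where open ≤-Reasoning

  combination+m*n≢small-combination : a < n → b < m → c * m + d * n + m * n ≢ a * m + b * n
  combination+m*n≢small-combination {a} {b} {c} {d} a<n b<m eq with c <? n
  ... | yes c<n = <⇒≱ b<m (subst (m ≤_) d+m≡b (m≤n+m m d))
    where
    d+m≡b : d + m ≡ b
    d+m≡b = proj₂ (combination-injective {b = d + m} {b' = b} c<n a<n (begin
      c * m + (d + m) * n       ≡⟨ cong (c * m +_) (*-distribʳ-+ n d m) ⟩
      c * m + (d * n + m * n)   ≡⟨ +-assoc (c * m) (d * n) (m * n) ⟨
      c * m + d * n + m * n     ≡⟨ eq ⟩
      a * m + b * n             ∎))
      where open ≡-Reasoning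
  ... | no c≮n  = <⇒≢ small<big (sym eq)
    where
    small<big : a * m + b * n < c * m + d * n + m * n
    small<big = begin-strict
      a * m + b * n          <⟨ +-mono-≤-< (*-monoˡ-≤ m (<⇒≤ a<n)) (*-monoˡ-< n b<m) ⟩
      n * m + m * n          ≤⟨ +-monoˡ-≤ (m * n) (≤-trans (*-monoˡ-≤ m (≮⇒≥ c≮n)) (m≤m+n (c * m) (d * n))) ⟩
      c * m + d * n + m * n  ∎
      where open ≤-Reasoning

module Gaps (A B m n : ℕ) .{{_ : NonZero m}} .{{_ : NonZero n}} (m⊥n : Coprime m n)
            (n≤A : n ≤ A) (m≤B : m ≤ B) where

  T : ℕ
  T = A * m + B * n

  data Representable : ℕ → Set where
    representable : a ≤ A → b ≤ B → Representable (a * m + b * n)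

  data Interior : ℕ → Set where
    interior : 0 < a → a < n → 0 < b → b < m → Interior (a * m + b * n)

  representable⇒≤T : Representable v → v ≤ T
  representable⇒≤T (representable a≤A b≤B) = +-mono-≤ (*-monoˡ-≤ m a≤A) (*-monoˡ-≤ n b≤B)

  interior⇒≤T : Interior z → z ≤ T
  interior⇒≤T (interior _ a<n _ b<m) =
    representable⇒≤T (representable (≤-trans (<⇒≤ a<n) n≤A) (≤-trans (<⇒≤ b<m) m≤B))

  interior⇒>0 : Interior z → 0 < z
  interior⇒>0 (interior {a} {b} _ _ 0<b _) = ≤-trans (*-monoˡ-< n 0<b) (m≤n+m (b * n) (a * m))

  m*n≤T : m * n ≤ T
  m*n≤T = begin
    m * n           ≡⟨ *-comm m n ⟩
    n * m           ≤⟨ *-monoˡ-≤ m n≤A ⟩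
    A * m           ≤⟨ m≤m+n (A * m) (B * n) ⟩
    T               ∎
    where open ≤-Reasoning

  -- The graph of gapOf, phrased without truncated subtraction.
  data GapOf (z v : ℕ) : Set where
    below : v + z ≡ m * n → GapOf z v
    above : m * n ≤ z → v + z ≡ T + m * n → GapOf z v

  gapOf : ℕ → ℕ
  gapOf z with z <? m * n
  ... | yes _ = m * n ∸ z
  ... | no  _ = T + m * n ∸ z

  gapOf-spec : Interior z → GapOf z (gapOf z)
  gapOf-spec {z} z-int with z <? m * n
  ... | yes z<mn = below (m∸n+n≡m (<⇒≤ z<mn))
  ... | no  z≮mn = above (≮⇒≥ z≮mn) (m∸n+n≡m (≤-trans (interior⇒≤T z-int) (m≤m+n T (m * n))))

  gap≤T : GapOf z v → v ≤ T
  gap≤T {z} {v} (below v+z≡mn)    = ≤-trans (subst (v ≤_) v+z≡mn (m≤m+n v z)) m*n≤T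
  gap≤T {z} {v} (above mn≤z v+z≡) =
    +-cancelʳ-≤ (m * n) v T (subst (v + m * n ≤_) v+z≡ (+-monoʳ-≤ v mn≤z))

  gap-unrepresentable : Interior z → GapOf z v → ¬ Representable v
  gap-unrepresentable (interior {a} {b} 0<a a<n 0<b b<m) (below v+z≡mn) (representable {a'} {b'} _ _) =
    positive-combination≢m*n m⊥n (≤-trans 0<a (m≤n+m a a')) (≤-trans 0<b (m≤n+m b b')) (begin
      (a' + a) * m + (b' + b) * n         ≡⟨ regroup a' a b' b m n ⟩
      a' * m + b' * n + (a * m + b * n)   ≡⟨ v+z≡mn ⟩
      m * n                               ∎)
    where
    open ≡-Reasoning
    regroup : ∀ a' a b' b m n → (a' + a) * m + (b' + b) * n ≡ a' * m + b' * n + (a * m + b * n)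
    regroup = solve-∀
  gap-unrepresentable (interior {a} {b} _ a<n _ b<m) (above _ v+z≡) (representable {a'} {b'} a'≤A b'≤B) =
    combination+m*n≢small-combination m⊥n {c = A∸a'} {d = B∸b'} a<n b<m
      (+-cancelˡ-≡ (a' * m + b' * n) _ _ (begin
        a' * m + b' * n + (A∸a' * m + B∸b' * n + m * n)   ≡⟨ regroup a' A∸a' b' B∸b' m n ⟩
        (a' + A∸a') * m + (b' + B∸b') * n + m * n         ≡⟨ cong₂ (λ x y → x * m + y * n + m * n) (m+[n∸m]≡n a'≤A) (m+[n∸m]≡n b'≤B) ⟩
        T + m * n                                         ≡⟨ v+z≡ ⟨
        a' * m + b' * n + (a * m + b * n)                 ∎))
    where
    open ≡-Reasoning
    A∸a' = A ∸ a'
    B∸b' = B ∸ b'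
    regroup : ∀ a' c b' d m n → a' * m + b' * n + (c * m + d * n + m * n) ≡ (a' + c) * m + (b' + d) * n + m * n
    regroup = solve-∀

  below-above-disjoint : Interior z → Interior z' → v + z ≡ m * n → v + z' ≡ T + m * n → ⊥
  below-above-disjoint {z} {z'} {v} z-int z'-int v+z≡ v+z'≡ =
    <⇒≱ (subst (T <_) (sym z'≡T+z) (m<m+n T (interior⇒>0 z-int))) (interior⇒≤T z'-int)
    where
    z'≡T+z : z' ≡ T + z
    z'≡T+z = +-cancelˡ-≡ v _ _ (begin
      v + z'        ≡⟨ v+z'≡ ⟩
      T + m * n     ≡⟨ cong (T +_) v+z≡ ⟨
      T + (v + z)   ≡⟨ x∙yz≈y∙xz T v z ⟩
      v + (T + z)   ∎)
      where open ≡-Reasoning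

  gap-injective : Interior z → Interior z' → GapOf z v → GapOf z' v → z ≡ z'
  gap-injective {v = v} _ _ (below v+z≡)    (below v+z'≡)    = +-cancelˡ-≡ v _ _ (trans v+z≡ (sym v+z'≡))
  gap-injective {v = v} _ _ (above _ v+z≡)  (above _ v+z'≡)  = +-cancelˡ-≡ v _ _ (trans v+z≡ (sym v+z'≡))
  gap-injective z-int z'-int (below v+z≡)   (above _ v+z'≡)  = ⊥-elim (below-above-disjoint z-int z'-int v+z≡ v+z'≡)
  gap-injective z-int z'-int (above _ v+z≡) (below v+z'≡)    = ⊥-elim (below-above-disjoint z'-int z-int v+z'≡ v+z≡)

  point : Fin (pred n) → Fin (pred m) → ℕ
  point i j = suc (toℕ i) * m + suc (toℕ j) * n

  point-interior : ∀ i j → Interior (point i j)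
  point-interior i j = interior z<s (suc-toℕ<n i) z<s (suc-toℕ<n j)

  gapAt : Fin (pred n) → Fin (pred m) → ℕ
  gapAt i j = gapOf (point i j)

  gapAt-injective : ∀ {i i' j j'} → gapAt i j ≡ gapAt i' j' → i ≡ i' × j ≡ j'
  gapAt-injective {i} {i'} {j} {j'} eq
    with i≡i' , j≡j' ← combination-injective m⊥n (suc-toℕ<n i) (suc-toℕ<n i')
           (gap-injective (point-interior i j) (point-interior i' j')
              (subst (GapOf (point i j)) eq (gapOf-spec (point-interior i j))) (gapOf-spec (point-interior i' j')))
    = toℕ-injective (suc-injective i≡i') , toℕ-injective (suc-injective j≡j')

  gaps : List ℕ
  gaps = cartesianProductWith gapAt (allFin (pred n)) (allFin (pred m))

  sums : List ℕ
  sums = deduplicate _≟_ (sumsList A B m n)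

  ∈sums⇒representable : v ∈ sums → Representable v
  ∈sums⇒representable v∈sums
    with a , a∈ , v∈row ← find (∈-concatMap⁻ _ {upTo (A + 1)} (∈-deduplicate⁻ _≟_ (sumsList A B m n) v∈sums))
    with b , b∈ , refl ← ∈-map⁻ (λ b → a * m + b * n) v∈row
    = representable (m<n+1⇒m≤n (∈-upTo⁻ a∈)) (m<n+1⇒m≤n (∈-upTo⁻ b∈))

  sums-gaps-disjoint : v ∈ sums → v ∈ gaps → ⊥
  sums-gaps-disjoint v∈sums v∈gaps
    with i , j , _ , _ , refl ← ∈-cartesianProductWith⁻ gapAt (allFin (pred n)) (allFin (pred m)) v∈gaps
    = gap-unrepresentable (point-interior i j) (gapOf-spec (point-interior i j)) (∈sums⇒representable v∈sums)

  ∈gaps⇒≤T : v ∈ gaps → v ≤ T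
  ∈gaps⇒≤T v∈gaps
    with i , j , _ , _ , refl ← ∈-cartesianProductWith⁻ gapAt (allFin (pred n)) (allFin (pred m)) v∈gaps
    = gap≤T (gapOf-spec (point-interior i j))

  length-gaps : length gaps ≡ pred n * pred m
  length-gaps = trans (length-cartesianProductWith gapAt (allFin (pred n)) (allFin (pred m)))
                      (cong₂ _*_ (length-tabulate {n = pred n} (λ i → i)) (length-tabulate {n = pred m} (λ j → j)))

  cardS+gaps≤T+1 : cardS A B m n + pred m * pred n ≤ T + 1
  cardS+gaps≤T+1 = begin
    length sums + pred m * pred n   ≡⟨ cong (length sums +_) (trans (*-comm (pred m) (pred n)) (sym length-gaps)) ⟩
    length sums + length gaps       ≡⟨ length-++ sums ⟨
    length (sums ++ gaps)           ≤⟨ unique-length≤bound (T + 1) sums++gaps-unique (++⁺ sums<T+1 gaps<T+1) ⟩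
    T + 1                           ∎
    where
    open ≤-Reasoning
    sums++gaps-unique : Unique (sums ++ gaps)
    sums++gaps-unique =
      Unique.++⁺ (deduplicate-! (sumsList A B m n))
                 (Unique.cartesianProductWith⁺ gapAt gapAt-injective (Unique.allFin⁺ _) (Unique.allFin⁺ _))
                 (λ (v∈sums , v∈gaps) → sums-gaps-disjoint v∈sums v∈gaps)
    sums<T+1 : All (_< T + 1) sums
    sums<T+1 = All.tabulate (m≤n⇒m<n+1 ∘ representable⇒≤T ∘ ∈sums⇒representable)
    gaps<T+1 : All (_< T + 1) gaps
    gaps<T+1 = All.tabulate (m≤n⇒m<n+1 ∘ ∈gaps⇒≤T)

lemma2 : (A B m n : ℕ) → 1 ≤ A → 1 ≤ B → 1 ≤ m → 1 ≤ n → Coprime m n →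
         A ≥ n → B ≥ m →
         cardS A B m n + (m ∸ 1) * (n ∸ 1) ≤ A * m + B * n + 1
lemma2 A B m@(suc _) n@(suc _) _ _ _ _ m⊥n n≤A m≤B = Gaps.cardS+gaps≤T+1 A B m n m⊥n n≤A m≤B
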